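{- Let $q$ be a prime power, $s\ge 2$, and let $\mathcal{RM}_q(1,s-1)$ be the first order $q$-ary Reed–Muller code of length $n=q^{s-1}$ and dimension $s$. Then for $0<r<s$ its $r$-th generalized weight enumerator is \[ W^{(r)}_{\mathcal{RM}_q(1,s-1)}(X,Y)=\left[{s-1\atop r-1}\right]_q Y^n+q^r\left[{s-1\atop r}\right]_q X^{q^{s-1-r}}Y^{q^{s-1}-q^{s-1-r}}, \] while $W^{(0)}_{\mathcal{RM}_q(1,s-1)}(X,Y)=X^n$ and $W^{(s)}_{\mathcal{RM}_q(1,s-1)}(X,Y)=Y^n$.
   Context: The first order $q$-ary Reed–Muller code $\mathcal{RM}_q(1,s-1)$ is the linear $[q^{s-1},s]$ code over $\mathbb{F}_q$ with the $s\times q^{s-1}$ generator matrix whose columns are the vectors $(1,v)^T$ for $v$ ranging over all of $\mathbb{F}_q^{s-1}$ (first row all ones). For a linear $[n,k]$ code $C$ over $\mathbb{F}_q$, the support of a subcode $D\subseteq C$ is the union of the supports of its codewords, and $\mathrm{wt}(D)$ is the size of the support. For $0\le r\le k$, $W^{(r)}_C(X,Y)=\sum_{w=0}^n A^{(r)}_w X^{n-w}Y^w$ where $A^{(r)}_w$ is the number of subcodes $D\subseteq C$ with $\dim D=r$ and $\mathrm{wt}(D)=w$. The Gaussian binomial $\left[{a\atop b}\right]_q$ is the number of $b$-dimensional subspaces of $\mathbb{F}_q^a$. -}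

module Defs where

open import Data.Nat using (ℕ; zero; suc; _+_; _*_; _∸_; _^_)
open import Data.Nat.Properties using () renaming (_≟_ to _≟ℕ_)
open import Data.Bool using (Bool; true; false; _∧_; _∨_; not; if_then_else_)
open import Data.Fin using (Fin; zero; suc; remQuot) renaming (_≟_ to _≟F_)
open import Data.Fin.Subset using (Subset; inside; outside; _∈_; ∣_∣)
open import Data.Vec using (Vec; []; _∷_; tabulate; lookup; zipWith; map; replicate)
open import Data.List using (List; length)
open import Data.List.Relation.Unary.All using (All)
open import Data.List.Relation.Unary.Unique.Propositional using (Unique)
import Data.List.Membership.Propositional as LMem
open import Data.Product using (Σ; ∃; _×_; _,_; proj₁; proj₂)
open import Algebra.Structures using (IsCommutativeRing)
open import Relation.Binary.PropositionalEquality using (_≡_; _≢_)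
open import Relation.Nullary.Decidable using (⌊_⌋)
open import Function using (_∘_; _⇔_)

-- A finite field with q elements, realised on the carrier Fin q with
-- propositional equality.  (Every finite field of order q is isomorphic
-- to one of these; q is then automatically a prime power, and for every
-- prime power q such a structure exists.)

record FiniteField (q : ℕ) : Set where
  field
    _+F_ _*F_ : Fin q → Fin q → Fin q
    -F_       : Fin q → Fin q
    0# 1#     : Fin q
    isCommutativeRing : IsCommutativeRing _≡_ _+F_ _*F_ -F_ 0# 1#
    0≢1       : 0# ≢ 1#
    inverse   : ∀ x → x ≢ 0# → ∃ λ y → x *F y ≡ 1#

gauss : ℕ → ℕ → ℕ → ℕ
gauss q a       zero    = 1
gauss q zero    (suc b) = 0
gauss q (suc a) (suc b) = gauss q a b + q ^ suc b * gauss q a (suc b)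

δ : ℕ → ℕ → ℕ
δ w m = if ⌊ w ≟ℕ m ⌋ then 1 else 0

CountIs : {A : Set} → (A → Set) → ℕ → Set
CountIs {A} P N = Σ (List A) λ xs →
  (length xs ≡ N) × Unique xs × All P xs × (∀ a → P a → a LMem.∈ xs)

module _ {q : ℕ} (F : FiniteField q) where
  open FiniteField F

  -- Enumeration of F^k: index i ∈ Fin (q^k) ↦ vector (bijective).
  decode : ∀ k → Fin (q ^ k) → Vec (Fin q) k
  decode zero    i = []
  decode (suc k) i = proj₁ (remQuot {q} (q ^ k) i) ∷ decode k (proj₂ (remQuot {q} (q ^ k) i))

  Word : ℕ → Set
  Word n = Vec (Fin q) n

  Code : ℕ → Set₁
  Code n = Word n → Set

  dot : ∀ {k} → Vec (Fin q) k → Vec (Fin q) k → Fin q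
  dot []       []       = 0#
  dot (a ∷ as) (b ∷ bs) = (a *F b) +F dot as bs

  zeroW : ∀ {n} → Word n
  zeroW = replicate _ 0#

  _⊕_ : ∀ {n} → Word n → Word n → Word n
  _⊕_ = zipWith _+F_

  _•_ : ∀ {n} → Fin q → Word n → Word n
  a • x = map (a *F_) x

  lincomb : ∀ {n r} → Vec (Fin q) r → Vec (Word n) r → Word n
  lincomb []       []       = zeroW
  lincomb (c ∷ cs) (b ∷ bs) = (c • b) ⊕ lincomb cs bs

  LinIndep : ∀ {n r} → Vec (Word n) r → Set
  LinIndep {n} {r} bs = ∀ (c : Vec (Fin q) r) → lincomb c bs ≡ zeroW → c ≡ replicate r 0#

  -- A set of words of length n is a Subset (q ^ n): word (decode n i)
  -- belongs to D iff i ∈ D.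
  WordSet : ℕ → Set
  WordSet n = Subset (q ^ n)

  IsSubcode : ∀ {n} → Code n → ℕ → WordSet n → Set
  IsSubcode {n} C r D =
    Σ (Vec (Word n) r) λ bs →
      LinIndep bs ×
      (∀ i → (i ∈ D) ⇔ (∃ λ c → decode n i ≡ lincomb c bs)) ×
      (∀ i → i ∈ D → C (decode n i))

  anyB : ∀ m → (Fin m → Bool) → Bool
  anyB zero    f = false
  anyB (suc m) f = f zero ∨ anyB m (f ∘ suc)

  supp : ∀ {n} → WordSet n → Subset n
  supp {n} D = tabulate λ j →
    anyB (q ^ n) λ i → lookup D i ∧ not ⌊ lookup (decode n i) j ≟F 0# ⌋

  wt : ∀ {n} → WordSet n → ℕ
  wt {n} D = ∣ supp {n} D ∣

  -- The r-th generalized weight enumerator of C equals the homogeneous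
  -- polynomial Σ_w f(w) X^(n-w) Y^w: for every w, the number of
  -- r-dimensional subcodes of weight w is f w.
  HasGWE : ∀ {n} → Code n → ℕ → (ℕ → ℕ) → Set
  HasGWE {n} C r f = ∀ w → CountIs {WordSet n} (λ D → IsSubcode {n} C r D × wt {n} D ≡ w) (f w)

  -- First order Reed–Muller code RM_q(1,k), length q^k, dimension k+1:
  -- codeword of message (m₀ , m') has coordinate at v ∈ F^k equal to
  -- m₀ + m'·v (column (1,v) of the generator matrix); columns ordered
  -- by the enumeration decode k.
  RM : ∀ k → Code (q ^ k)
  RM k x = Σ (Fin q) λ m₀ → Σ (Vec (Fin q) k) λ m' →
    x ≡ tabulate (λ j → m₀ +F dot m' (decode k j))

module Submission where

open import Defs
open import Data.Nat using (ℕ; _+_; _*_; _∸_; _^_; _≤_; _<_)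
open import Data.Product using (_×_)
open import Data.Nat using (zero; suc; s≤s)
open import Data.Product using (_,_)
open import Data.Nat.Properties using (m≤n⇒m≤1+n; n<1+n; *-zeroʳ)
open import Relation.Binary.PropositionalEquality using (_≡_; refl)

-- The encoding (a , v) ↦ (x ↦ a + v ⊙ x) is a linear bijection from the
-- message space F^(1+m) onto RM(1,m), so r-dimensional subcodes correspond
-- to r-dimensional subspaces U of F^(1+m).  Each U has a unique echelon
-- form with respect to the first coordinate: either e₁ ∈ U (a "pivot"
-- form; U contains the all-one word, so its support is everything, q^m),
-- or U is the graph of a linear form on an r-dimensional subspace of F^m
-- (a "graph" form; the coordinates outside the support are the common
-- zeros of r independent affine functions, q^(m-r) points).  There are
-- [m, r-1]_q pivot forms and q^r [m, r]_q graph forms: the q-Pascal rule.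

module Counting where

  open import Data.Nat using (z≤n)
  open import Data.Nat.Properties using (≤-antisym; +-suc; *-identityʳ; *-zeroʳ; m+n∸n≡m)
    renaming (_≟_ to _≟ℕ_)
  open import Data.Bool using (Bool; true; false)
  open import Data.Fin using (Fin; zero; suc)
  open import Data.Fin.Properties using (suc-injective)
  open import Data.Fin.Subset using (∣_∣)
  open import Data.Vec using (tabulate)
  open import Data.List using (List; []; _∷_; length; map; _++_)
  open import Data.List.Properties using (length-map; length-++)
  open import Data.List.Relation.Unary.All as All using (All; []; _∷_)
  import Data.List.Relation.Unary.All.Properties as All
  open import Data.List.Relation.Unary.Any using (here; there)
  open import Data.List.Relation.Unary.AllPairs using ([]; _∷_)
  open import Data.List.Relation.Unary.Unique.Propositional using (Unique)
  open import Data.List.Relation.Unary.Unique.Propositional.Properties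
    using (map⁺; ++⁺)
  open import Data.List.Membership.Propositional using (_∈_)
  open import Data.List.Membership.Propositional.Properties
    using (∈-map⁺; ∈-++⁺ˡ; ∈-++⁺ʳ; ∈-++⁻; ∈-∃++)
  open import Data.Product using (Σ; ∃; _,_; proj₂)
  open import Data.Sum using (_⊎_; inj₁; inj₂)
  open import Data.Unit using (⊤; tt)
  open import Data.Empty using (⊥; ⊥-elim)
  open import Relation.Nullary using (¬_; yes; no)
  open import Relation.Binary.PropositionalEquality

  private variable
    A B : Set

  unique-length-≤ : (xs ys : List A) → Unique xs → (∀ {x} → x ∈ xs → x ∈ ys) →
                    length xs ≤ length ys
  unique-length-≤ [] ys _ _ = z≤n
  unique-length-≤ (x ∷ xs) ys (x∉xs ∷ u) xs⊆ys with ∈-∃++ (xs⊆ys (here refl))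
  ... | ys₁ , ys₂ , refl =
    subst (suc (length xs) ≤_) (sym (trans (length-++ ys₁) (+-suc (length ys₁) (length ys₂))))
      (s≤s (subst (length xs ≤_) (length-++ ys₁) (unique-length-≤ xs (ys₁ ++ ys₂) u xs⊆rest)))
    where
    different : ∀ {y zs} → All (x ≢_) zs → y ∈ zs → y ≢ x
    different (x≢y ∷ _) (here refl) y≡x = x≢y (sym y≡x)
    different (_ ∷ ns) (there y∈) y≡x = different ns y∈ y≡x
    xs⊆rest : ∀ {y} → y ∈ xs → y ∈ ys₁ ++ ys₂
    xs⊆rest {y} y∈xs with ∈-++⁻ ys₁ (xs⊆ys (there y∈xs))
    ... | inj₁ y∈ys₁ = ∈-++⁺ˡ y∈ys₁
    ... | inj₂ (here y≡x) = ⊥-elim (different x∉xs y∈xs y≡x)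
    ... | inj₂ (there y∈ys₂) = ∈-++⁺ʳ ys₁ y∈ys₂

  count-unique : ∀ {P : A → Set} {m n} → CountIs P m → CountIs P n → m ≡ n
  count-unique (xs , refl , u , all , complete) (ys , refl , u′ , all′ , complete′) =
    ≤-antisym (unique-length-≤ xs ys u  λ p → complete′ _ (All.lookup all p))
              (unique-length-≤ ys xs u′ λ p → complete  _ (All.lookup all′ p))

  count-⇔ : ∀ {P Q : A → Set} {n} → (∀ a → P a → Q a) → (∀ a → Q a → P a) →
            CountIs P n → CountIs Q n
  count-⇔ P⇒Q Q⇒P (xs , len , u , all , complete) =
    xs , len , u , All.map (P⇒Q _) all , λ a q → complete a (Q⇒P a q)

  count-empty : ∀ {P : A → Set} → (∀ a → ¬ P a) → CountIs P 0
  count-empty none = [] , refl , [] , [] , λ a p → ⊥-elim (none a p)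

  count-singleton : ∀ {P : A → Set} a → P a → (∀ b → P b → b ≡ a) → CountIs P 1
  count-singleton a p only = a ∷ [] , refl , [] ∷ [] , p ∷ [] , λ b q → here (only b q)

  count-image : ∀ {P : A → Set} {Q : B → Set} {n} (f : A → B) →
                (∀ {x y} → f x ≡ f y → x ≡ y) →
                (∀ a → P a → Q (f a)) → (∀ b → Q b → ∃ λ a → P a × b ≡ f a) →
                CountIs P n → CountIs Q n
  count-image f f-inj P⇒Q Q⇒P (xs , len , u , all , complete) =
    map f xs , trans (length-map f xs) len , map⁺ f-inj u ,
    All.map⁺ (All.map (P⇒Q _) all) , image-complete
    where
    image-complete : ∀ b → _ → b ∈ map f xs
    image-complete b q with Q⇒P b q
    ... | a , p , refl = ∈-map⁺ f (complete a p)

  count-⊎ : ∀ {P Q : A → Set} {m n} → CountIs P m → CountIs Q n →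
            (∀ a → P a → Q a → ⊥) → CountIs (λ a → P a ⊎ Q a) (m + n)
  count-⊎ (xs , refl , u , all , complete) (ys , refl , u′ , all′ , complete′) disjoint =
    xs ++ ys , length-++ xs ,
    ++⁺ u u′ (λ { (p , q) → disjoint _ (All.lookup all p) (All.lookup all′ q) }) ,
    All.++⁺ (All.map inj₁ all) (All.map inj₂ all′) ,
    λ { a (inj₁ p) → ∈-++⁺ˡ (complete a p) ; a (inj₂ q) → ∈-++⁺ʳ xs (complete′ a q) }

  count-Σ-list : ∀ {Q : A → B → Set} {n} (xs : List A) → Unique xs →
                 (∀ a → CountIs (Q a) n) →
                 CountIs {A × B} (λ (a , b) → a ∈ xs × Q a b) (length xs * n)
  count-Σ-list [] [] fibre = count-empty λ { _ (() , _) }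
  count-Σ-list {A = A} {B = B} {Q = Q} {n = n} (x ∷ xs) (x∉xs ∷ u) fibre =
    count-⇔ merge split (count-⊎ over-x (count-Σ-list xs u fibre) disjoint)
    where
    over-x : CountIs {A × B} (λ (a , b) → a ≡ x × Q x b) n
    over-x = count-image (x ,_) (cong proj₂) (λ b q → refl , q)
                         (λ { (a , b) (refl , q) → b , q , refl }) (fibre x)
    disjoint : ∀ ((a , b) : A × B) → a ≡ x × Q x b → a ∈ xs × Q a b → ⊥
    disjoint (a , b) (refl , _) (a∈xs , _) = All.lookup x∉xs a∈xs refl
    merge : ∀ ((a , b) : A × B) → (a ≡ x × Q x b) ⊎ (a ∈ xs × Q a b) → a ∈ x ∷ xs × Q a b
    merge (a , b) (inj₁ (refl , q)) = here refl , q
    merge (a , b) (inj₂ (a∈xs , q)) = there a∈xs , q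
    split : ∀ ((a , b) : A × B) → a ∈ x ∷ xs × Q a b → (a ≡ x × Q x b) ⊎ (a ∈ xs × Q a b)
    split (a , b) (here refl , q) = inj₁ (refl , q)
    split (a , b) (there a∈xs , q) = inj₂ (a∈xs , q)

  count-× : ∀ {P : A → Set} {Q : A → B → Set} {m n} → CountIs P m →
            (∀ a → CountIs (Q a) n) → CountIs {A × B} (λ (a , b) → P a × Q a b) (m * n)
  count-× (xs , refl , u , all , complete) fibre =
    count-⇔ (λ _ (a∈xs , q) → All.lookup all a∈xs , q) (λ _ (p , q) → complete _ p , q)
            (count-Σ-list xs u fibre)

  count-Fin-suc-yes : ∀ {N} {P : Fin (suc N) → Set} {k} → P zero →
                      CountIs (λ j → P (suc j)) k → CountIs P (suc k)
  count-Fin-suc-yes {P = P} p₀ (xs , refl , u , all , complete) =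
    zero ∷ map suc xs , cong suc (length-map suc xs) ,
    All.map⁺ (All.universal (λ _ ()) xs) ∷ map⁺ suc-injective u ,
    p₀ ∷ All.map⁺ all , complete′
    where
    complete′ : ∀ j → P j → j ∈ zero ∷ map suc xs
    complete′ zero    _ = here refl
    complete′ (suc j) p = there (∈-map⁺ suc (complete j p))

  count-Fin-suc-no : ∀ {N} {P : Fin (suc N) → Set} {k} → ¬ P zero →
                     CountIs (λ j → P (suc j)) k → CountIs P k
  count-Fin-suc-no {P = P} ¬p₀ (xs , refl , u , all , complete) =
    map suc xs , length-map suc xs , map⁺ suc-injective u , All.map⁺ all , complete′
    where
    complete′ : ∀ j → P j → j ∈ map suc xs
    complete′ zero    p = ⊥-elim (¬p₀ p)
    complete′ (suc j) p = ∈-map⁺ suc (complete j p)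

  count-Fin : ∀ N → CountIs {Fin N} (λ _ → ⊤) N
  count-Fin zero    = count-empty λ ()
  count-Fin (suc N) = count-Fin-suc-yes tt (count-Fin N)

  false-entries : ∀ N (g : Fin N → Bool) →
                  Σ ℕ λ k → CountIs (λ j → g j ≡ false) k × ∣ tabulate g ∣ + k ≡ N
  false-entries zero    g = 0 , count-empty (λ ()) , refl
  false-entries (suc N) g with false-entries N (λ j → g (suc j))
  ... | k , count , size with g zero in g₀
  ...   | true  = k , count-Fin-suc-no (λ g₀≡false → true≢false (trans (sym g₀) g₀≡false)) count ,
                  cong suc size
    where
    true≢false : true ≢ false
    true≢false ()
  ...   | false = suc k , count-Fin-suc-yes g₀ count , trans (+-suc _ k) (cong suc size)

  ∣tabulate∣≡ : ∀ N (g : Fin N → Bool) Z → CountIs (λ j → g j ≡ false) Z →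
                ∣ tabulate g ∣ ≡ N ∸ Z
  ∣tabulate∣≡ N g Z count with false-entries N g
  ... | k , count′ , size with count-unique count count′
  ... | refl = trans (sym (m+n∸n≡m _ Z)) (cong (_∸ Z) size)

  count-weight : ∀ {N} c (f : A → ℕ) → (∀ a → f a ≡ c) → CountIs {A} (λ _ → ⊤) N →
                 ∀ w → CountIs (λ a → f a ≡ w) (N * δ w c)
  count-weight {N = N} c f const all w with w ≟ℕ c
  ... | yes refl = subst (CountIs _) (sym (*-identityʳ N)) (count-⇔ (λ a _ → const a) (λ _ _ → tt) all)
  ... | no w≢c   = subst (CountIs _) (sym (*-zeroʳ N)) (count-empty λ a fa≡w → w≢c (trans (sym fa≡w) (const a)))

open Counting

gauss-above : ∀ q a b → a < b → gauss q a b ≡ 0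
gauss-above q zero    (suc b) _ = refl
gauss-above q (suc a) (suc b) (s≤s a<b)
  rewrite gauss-above q a b a<b | gauss-above q a (suc b) (m≤n⇒m≤1+n a<b) = *-zeroʳ (q ^ suc b)

gauss-diagonal : ∀ q a → gauss q a a ≡ 1
gauss-diagonal q zero    = refl
gauss-diagonal q (suc a)
  rewrite gauss-diagonal q a | gauss-above q a (suc a) (n<1+n a) | *-zeroʳ (q ^ suc a) = refl

module Theory {q : ℕ} (F : FiniteField q) where

  open import Data.Nat using (z≤n)
  import Data.Nat.Properties as ℕ
  open import Data.Fin using (Fin; combine; remQuot) renaming (_≟_ to _≟F_; zero to fzero; suc to fsuc)
  open import Data.Fin.Properties using (remQuot-combine; combine-remQuot; any?)
  open import Data.Vec using (Vec; []; _∷_; zipWith; map; head; tail; tabulate; lookup)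
  open import Data.Vec.Properties
    using (≡-dec; lookup∘tabulate; tabulate-cong; tabulate-∘; tabulate∘lookup; []=⇒lookup; lookup⇒[]=;
           lookup-zipWith; lookup-map; lookup-replicate)
  open import Data.Bool using (Bool; true; false; _∧_; not)
  open import Data.Fin.Subset using (_∈_)
  open import Data.Bool.Properties using (T-≡; not-injective)
  open import Relation.Nullary.Decidable using (⌊_⌋; toWitness; dec-true; isYes≗does)
  open import Function.Bundles using (mk⇔; Equivalence; _⇔_)
  open import Data.Vec.Relation.Unary.All using (All; []; _∷_)
  import Data.Vec.Relation.Unary.All as All
  import Data.Vec.Relation.Unary.All.Properties as All
  open import Data.Vec.Relation.Unary.Any using (Any; here; there)
  open import Data.Product using (Σ; ∃; _,_; proj₁; proj₂; uncurry)
  open import Data.Sum using (_⊎_; inj₁; inj₂)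
  open import Data.Unit using (⊤; tt)
  open import Data.Empty using (⊥; ⊥-elim)
  open import Relation.Nullary using (¬_; yes; no; Dec)
  open import Algebra.Bundles using (CommutativeRing; Ring)
  import Algebra.Properties.Ring as RingProperties
  import Algebra.Properties.Group as GroupProperties
  open import Algebra.Structures using (IsCommutativeRing)
  open import Relation.Binary.PropositionalEquality
  open ≡-Reasoning

  open FiniteField F
  open IsCommutativeRing isCommutativeRing
    using (+-assoc; +-comm; *-assoc; *-comm; distribˡ; distribʳ; zeroˡ; zeroʳ;
           +-identityˡ; +-identityʳ; *-identityˡ; *-identityʳ; -‿inverseʳ)

  fieldRing : Ring _ _
  fieldRing = CommutativeRing.ring (record { isCommutativeRing = isCommutativeRing })
  open RingProperties fieldRing using (-1*x≈-x)
  open GroupProperties (Ring.+-group fieldRing) using (∙-cancelˡ; inverseʳ-unique; x∙y⁻¹≈ε⇒x≈y)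

  K : Set
  K = Fin q

  V : ℕ → Set
  V n = Vec K n

  infixl 6 _⊞_
  infixr 7 _·_
  infix  25 _⊙_

  𝟎 : ∀ {n} → V n
  𝟎 = zeroW F

  _⊞_ : ∀ {n} → V n → V n → V n
  _⊞_ = _⊕_ F

  _·_ : ∀ {n} → K → V n → V n
  _·_ = _•_ F

  _⊙_ : ∀ {k} → V k → V k → K
  _⊙_ = dot F

  lc : ∀ {n r} → V r → Vec (V n) r → V n
  lc = lincomb F

  -- Negation appears as multiplication by -1#, matching the scalar action _•_.
  -1# : K
  -1# = -F 1#

  x-x≡0 : ∀ x → x +F (-1# *F x) ≡ 0#
  x-x≡0 x = trans (cong (x +F_) (-1*x≈-x x)) (-‿inverseʳ x)

  x-y≡0⇒x≡y : ∀ x y → x +F (-1# *F y) ≡ 0# → x ≡ y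
  x-y≡0⇒x≡y x y x-y≡0 = x∙y⁻¹≈ε⇒x≈y x y (trans (cong (x +F_) (sym (-1*x≈-x y))) x-y≡0)

  x+y≡0⇒y≡-x : ∀ x y → x +F y ≡ 0# → y ≡ -1# *F x
  x+y≡0⇒y≡-x x y x+y≡0 = trans (inverseʳ-unique x y x+y≡0) (sym (-1*x≈-x x))

  x+[y-x]≡y : ∀ x y → x +F (y +F (-1# *F x)) ≡ y
  x+[y-x]≡y x y = begin
    x +F (y +F (-1# *F x))   ≡⟨ cong (x +F_) (+-comm y _) ⟩
    x +F ((-1# *F x) +F y)   ≡⟨ sym (+-assoc x _ y) ⟩
    (x +F (-1# *F x)) +F y   ≡⟨ cong (_+F y) (x-x≡0 x) ⟩
    0# +F y                  ≡⟨ +-identityˡ y ⟩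
    y                        ∎

  +-cancelˡ : ∀ x y z → x +F y ≡ x +F z → y ≡ z
  +-cancelˡ = ∙-cancelˡ

  +-interchange : ∀ a b c d → (a +F b) +F (c +F d) ≡ (a +F c) +F (b +F d)
  +-interchange a b c d = begin
    (a +F b) +F (c +F d)   ≡⟨ +-assoc a b _ ⟩
    a +F (b +F (c +F d))   ≡⟨ cong (a +F_) (sym (+-assoc b c d)) ⟩
    a +F ((b +F c) +F d)   ≡⟨ cong (λ t → a +F (t +F d)) (+-comm b c) ⟩
    a +F ((c +F b) +F d)   ≡⟨ cong (a +F_) (+-assoc c b d) ⟩
    a +F (c +F (b +F d))   ≡⟨ sym (+-assoc a c _) ⟩
    (a +F c) +F (b +F d)   ∎

  ⊞-comm : ∀ {n} (x y : V n) → x ⊞ y ≡ y ⊞ x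
  ⊞-comm []      []      = refl
  ⊞-comm (a ∷ x) (b ∷ y) = cong₂ _∷_ (+-comm a b) (⊞-comm x y)

  ⊞-identityˡ : ∀ {n} (x : V n) → 𝟎 ⊞ x ≡ x
  ⊞-identityˡ []      = refl
  ⊞-identityˡ (a ∷ x) = cong₂ _∷_ (+-identityˡ a) (⊞-identityˡ x)

  ⊞-identityʳ : ∀ {n} (x : V n) → x ⊞ 𝟎 ≡ x
  ⊞-identityʳ []      = refl
  ⊞-identityʳ (a ∷ x) = cong₂ _∷_ (+-identityʳ a) (⊞-identityʳ x)

  ⊞-interchange : ∀ {n} (x y u w : V n) → (x ⊞ y) ⊞ (u ⊞ w) ≡ (x ⊞ u) ⊞ (y ⊞ w)
  ⊞-interchange []      []      []      []      = refl
  ⊞-interchange (a ∷ x) (b ∷ y) (c ∷ u) (d ∷ w) =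
    cong₂ _∷_ (+-interchange a b c d) (⊞-interchange x y u w)

  x-x≡𝟎 : ∀ {n} (x : V n) → x ⊞ -1# · x ≡ 𝟎
  x-x≡𝟎 []      = refl
  x-x≡𝟎 (a ∷ x) = cong₂ _∷_ (x-x≡0 a) (x-x≡𝟎 x)

  ·-distribˡ : ∀ {n} a (x y : V n) → a · (x ⊞ y) ≡ a · x ⊞ a · y
  ·-distribˡ a []      []      = refl
  ·-distribˡ a (b ∷ x) (c ∷ y) = cong₂ _∷_ (distribˡ a b c) (·-distribˡ a x y)

  ·-distribʳ : ∀ {n} a b (x : V n) → (a +F b) · x ≡ a · x ⊞ b · x
  ·-distribʳ a b []      = refl
  ·-distribʳ a b (c ∷ x) = cong₂ _∷_ (distribʳ c a b) (·-distribʳ a b x)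

  ·-assoc : ∀ {n} a b (x : V n) → (a *F b) · x ≡ a · (b · x)
  ·-assoc a b []      = refl
  ·-assoc a b (c ∷ x) = cong₂ _∷_ (*-assoc a b c) (·-assoc a b x)

  ·-identity : ∀ {n} (x : V n) → 1# · x ≡ x
  ·-identity []      = refl
  ·-identity (c ∷ x) = cong₂ _∷_ (*-identityˡ c) (·-identity x)

  0·x≡𝟎 : ∀ {n} (x : V n) → 0# · x ≡ 𝟎
  0·x≡𝟎 []      = refl
  0·x≡𝟎 (c ∷ x) = cong₂ _∷_ (zeroˡ c) (0·x≡𝟎 x)

  a·𝟎≡𝟎 : ∀ {n} a → a · 𝟎 {n} ≡ 𝟎
  a·𝟎≡𝟎 {zero}  a = refl
  a·𝟎≡𝟎 {suc n} a = cong₂ _∷_ (zeroʳ a) (a·𝟎≡𝟎 a)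

  𝟎⊙x≡0 : ∀ {r} (x : V r) → 𝟎 ⊙ x ≡ 0#
  𝟎⊙x≡0 []      = refl
  𝟎⊙x≡0 (a ∷ x) = trans (cong₂ _+F_ (zeroˡ a) (𝟎⊙x≡0 x)) (+-identityʳ 0#)

  x⊙𝟎≡0 : ∀ {r} (x : V r) → x ⊙ 𝟎 ≡ 0#
  x⊙𝟎≡0 []      = refl
  x⊙𝟎≡0 (a ∷ x) = trans (cong₂ _+F_ (zeroʳ a) (x⊙𝟎≡0 x)) (+-identityʳ 0#)

  ⊙-distribʳ : ∀ {k} (v v′ x : V k) → (v ⊞ v′) ⊙ x ≡ v ⊙ x +F v′ ⊙ x
  ⊙-distribʳ []      []        []      = sym (+-identityʳ 0#)
  ⊙-distribʳ (a ∷ v) (b ∷ v′) (c ∷ x) = begin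
    ((a +F b) *F c) +F (v ⊞ v′) ⊙ x            ≡⟨ cong₂ _+F_ (distribʳ c a b) (⊙-distribʳ v v′ x) ⟩
    ((a *F c) +F (b *F c)) +F (v ⊙ x +F v′ ⊙ x) ≡⟨ +-interchange _ _ _ _ ⟩
    ((a *F c) +F v ⊙ x) +F ((b *F c) +F v′ ⊙ x) ∎

  ⊙-·ˡ : ∀ {k} a (v x : V k) → (a · v) ⊙ x ≡ a *F (v ⊙ x)
  ⊙-·ˡ a []      []      = sym (zeroʳ a)
  ⊙-·ˡ a (b ∷ v) (c ∷ x) = begin
    ((a *F b) *F c) +F (a · v) ⊙ x  ≡⟨ cong₂ _+F_ (*-assoc a b c) (⊙-·ˡ a v x) ⟩
    (a *F (b *F c)) +F (a *F (v ⊙ x)) ≡⟨ sym (distribˡ a _ _) ⟩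
    a *F ((b *F c) +F v ⊙ x)        ∎

  lc-𝟎 : ∀ {n r} (B : Vec (V n) r) → lc 𝟎 B ≡ 𝟎
  lc-𝟎 []      = refl
  lc-𝟎 (b ∷ B) = trans (cong₂ _⊞_ (0·x≡𝟎 b) (lc-𝟎 B)) (⊞-identityˡ 𝟎)

  lc-⊞ : ∀ {n r} (c c′ : V r) (B : Vec (V n) r) → lc (c ⊞ c′) B ≡ lc c B ⊞ lc c′ B
  lc-⊞ []       []         []      = sym (⊞-identityˡ 𝟎)
  lc-⊞ (a ∷ c) (a′ ∷ c′) (b ∷ B) =
    trans (cong₂ _⊞_ (·-distribʳ a a′ b) (lc-⊞ c c′ B))
          (⊞-interchange (a · b) (a′ · b) (lc c B) (lc c′ B))

  lc-· : ∀ {n r} a (c : V r) (B : Vec (V n) r) → lc (a · c) B ≡ a · lc c B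
  lc-· a []      []      = sym (a·𝟎≡𝟎 a)
  lc-· a (x ∷ c) (b ∷ B) =
    trans (cong₂ _⊞_ (·-assoc a x b) (lc-· a c B)) (sym (·-distribˡ a (x · b) (lc c B)))

  lc-zipWith-⊞ : ∀ {n r} (d : V r) (A B : Vec (V n) r) →
                 lc d (zipWith _⊞_ A B) ≡ lc d A ⊞ lc d B
  lc-zipWith-⊞ []      []      []      = sym (⊞-identityˡ 𝟎)
  lc-zipWith-⊞ (a ∷ d) (x ∷ A) (y ∷ B) =
    trans (cong₂ _⊞_ (·-distribˡ a x y) (lc-zipWith-⊞ d A B))
          (⊞-interchange (a · x) (a · y) (lc d A) (lc d B))

  lc-multiples : ∀ {n r} (d ν : V r) (c : V n) → lc d (map (_· c) ν) ≡ (d ⊙ ν) · c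
  lc-multiples []      []      c = sym (0·x≡𝟎 c)
  lc-multiples (a ∷ d) (x ∷ ν) c =
    trans (cong₂ _⊞_ (sym (·-assoc a x c)) (lc-multiples d ν c))
          (sym (·-distribʳ (a *F x) (d ⊙ ν) c))

  lc-∷ : ∀ {n r} (c h : V r) (T : Vec (V n) r) → lc c (zipWith _∷_ h T) ≡ (c ⊙ h) ∷ lc c T
  lc-∷ []      []      []      = refl
  lc-∷ (a ∷ c) (x ∷ h) (t ∷ T) rewrite lc-∷ c h T = refl

  split-heads : ∀ {k r} (β : Vec (V (suc k)) r) → β ≡ zipWith _∷_ (map head β) (map tail β)
  split-heads []             = refl
  split-heads ((a ∷ x) ∷ β) = cong ((a ∷ x) ∷_) (split-heads β)

  lc-heads : ∀ {k r} (c : V r) (β : Vec (V (suc k)) r) →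
             lc c β ≡ (c ⊙ map head β) ∷ lc c (map tail β)
  lc-heads c β = trans (cong (lc c) (split-heads β)) (lc-∷ c (map head β) (map tail β))

  lc-compose : ∀ {n k r} (d : V r) (C : Vec (V k) r) (B : Vec (V n) k) →
               lc d (map (λ c → lc c B) C) ≡ lc (lc d C) B
  lc-compose []      []      B = sym (lc-𝟎 B)
  lc-compose (a ∷ d) (c ∷ C) B = begin
    a · lc c B ⊞ lc d (map (λ c → lc c B) C) ≡⟨ cong₂ _⊞_ (sym (lc-· a c B)) (lc-compose d C B) ⟩
    lc (a · c) B ⊞ lc (lc d C) B              ≡⟨ sym (lc-⊞ (a · c) (lc d C) B) ⟩
    lc (a · c ⊞ lc d C) B                     ∎

  InSpan : ∀ {n r} → Vec (V n) r → V n → Set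
  InSpan B x = ∃ λ c → x ≡ lc c B

  SameSpan : ∀ {n k r} → Vec (V n) k → Vec (V n) r → Set
  SameSpan B C = All (InSpan C) B × All (InSpan B) C

  span-⊞ : ∀ {n r} (B : Vec (V n) r) {x y} → InSpan B x → InSpan B y → InSpan B (x ⊞ y)
  span-⊞ B (c , refl) (c′ , refl) = c ⊞ c′ , sym (lc-⊞ c c′ B)

  span-· : ∀ {n r} (B : Vec (V n) r) a {x} → InSpan B x → InSpan B (a · x)
  span-· B a (c , refl) = a · c , sym (lc-· a c B)

  span-lc : ∀ {n r k} (B : Vec (V n) r) (c : V k) (C : Vec (V n) k) →
            All (InSpan B) C → InSpan B (lc c C)
  span-lc B []      []      []       = 𝟎 , sym (lc-𝟎 B)
  span-lc B (a ∷ c) (x ∷ C) (p ∷ ps) = span-⊞ B (span-· B a p) (span-lc B c C ps)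

  span-trans : ∀ {n r k} (B : Vec (V n) r) (C : Vec (V n) k) → All (InSpan B) C →
               ∀ {x} → InSpan C x → InSpan B x
  span-trans B C ps (c , refl) = span-lc B c C ps

  span-∷ : ∀ {n r} (b : V n) (B : Vec (V n) r) {x} → InSpan B x → InSpan (b ∷ B) x
  span-∷ b B (c , refl) = 0# ∷ c , sym (trans (cong (_⊞ lc c B) (0·x≡𝟎 b)) (⊞-identityˡ _))

  span-self : ∀ {n r} (B : Vec (V n) r) → All (InSpan B) B
  span-self []      = []
  span-self (b ∷ B) =
    (1# ∷ 𝟎 , sym (trans (cong₂ _⊞_ (·-identity b) (lc-𝟎 B)) (⊞-identityʳ b))) ∷
    All.map (span-∷ b B) (span-self B)

  -- Steinitz: more than k vectors in F^k are linearly dependent.  The proof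
  -- is Gaussian elimination on the first coordinate.

  heads≡𝟎 : ∀ {k r} {C : Vec (V (suc k)) r} → All (λ v → head v ≡ 0#) C → map head C ≡ 𝟎
  heads≡𝟎 []       = refl
  heads≡𝟎 (p ∷ ps) = cong₂ _∷_ p (heads≡𝟎 ps)

  lc-heads-zero : ∀ {k r} (d : V r) {C : Vec (V (suc k)) r} → All (λ v → head v ≡ 0#) C →
                  lc d C ≡ 0# ∷ lc d (map tail C)
  lc-heads-zero d {C} zeros =
    trans (lc-heads d C) (cong (_∷ lc d (map tail C)) (trans (cong (d ⊙_) (heads≡𝟎 zeros)) (x⊙𝟎≡0 d)))

  heads-zero? : ∀ {k r} (C : Vec (V (suc k)) r) →
                All (λ v → head v ≡ 0#) C ⊎ Any (λ v → head v ≢ 0#) C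
  heads-zero? []      = inj₁ []
  heads-zero? (c ∷ C) with head c ≟F 0# | heads-zero? C
  ... | no  c≢0 | _         = inj₂ (here c≢0)
  ... | yes c≡0 | inj₁ ps   = inj₁ (c≡0 ∷ ps)
  ... | yes _   | inj₂ some = inj₂ (there some)

  record Elimination {k r} (C : Vec (V (suc k)) (suc r)) : Set where
    field
      reduced      : Vec (V k) r
      lift         : V r → V (suc r)
      lift-spec    : ∀ d → lc (lift d) C ≡ 0# ∷ lc d reduced
      lift-nonzero : ∀ d → lift d ≡ 𝟎 → d ≡ 𝟎

  -- Eliminate using the first vector, whose head a is nonzero: replace
  -- each other vector x by x - (head x / a)·(a ∷ c).
  eliminate-by-first : ∀ {k r} (a : K) (c : V k) (C : Vec (V (suc k)) r) → a ≢ 0# →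
                       Elimination ((a ∷ c) ∷ C)
  eliminate-by-first {k} a c C a≢0 = record
    { reduced = map tail (map row C)
    ; lift = λ d → (d ⊙ map ν C) ∷ d
    ; lift-spec = spec
    ; lift-nonzero = λ d → cong tail
    }
    where
    a⁻¹ : K
    a⁻¹ = proj₁ (inverse a a≢0)
    ν : V (suc k) → K
    ν x = -1# *F (head x *F a⁻¹)
    row : V (suc k) → V (suc k)
    row x = x ⊞ ν x · (a ∷ c)
    row-head : ∀ x → head (row x) ≡ 0#
    row-head (h ∷ x) = begin
      h +F ((-1# *F (h *F a⁻¹)) *F a) ≡⟨ cong (h +F_) (*-assoc -1# _ a) ⟩
      h +F (-1# *F ((h *F a⁻¹) *F a)) ≡⟨ cong (λ t → h +F (-1# *F t)) (*-assoc h a⁻¹ a) ⟩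
      h +F (-1# *F (h *F (a⁻¹ *F a))) ≡⟨ cong (λ t → h +F (-1# *F (h *F t)))
                                              (trans (*-comm a⁻¹ a) (proj₂ (inverse a a≢0))) ⟩
      h +F (-1# *F (h *F 1#))         ≡⟨ cong (λ t → h +F (-1# *F t)) (*-identityʳ h) ⟩
      h +F (-1# *F h)                 ≡⟨ x-x≡0 h ⟩
      0#                              ∎
    rows-head : ∀ {r′} (C′ : Vec (V (suc k)) r′) → All (λ v → head v ≡ 0#) (map row C′)
    rows-head []       = []
    rows-head (x ∷ C′) = row-head x ∷ rows-head C′
    rows : ∀ {r′} (C′ : Vec (V (suc k)) r′) → map row C′ ≡ zipWith _⊞_ C′ (map (_· (a ∷ c)) (map ν C′))
    rows []       = refl
    rows (x ∷ C′) = cong (row x ∷_) (rows C′)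
    spec : ∀ d → lc ((d ⊙ map ν C) ∷ d) ((a ∷ c) ∷ C) ≡ 0# ∷ lc d (map tail (map row C))
    spec d = begin
      (d ⊙ map ν C) · (a ∷ c) ⊞ lc d C             ≡⟨ ⊞-comm _ _ ⟩
      lc d C ⊞ (d ⊙ map ν C) · (a ∷ c)
        ≡⟨ cong (lc d C ⊞_) (sym (lc-multiples d (map ν C) (a ∷ c))) ⟩
      lc d C ⊞ lc d (map (_· (a ∷ c)) (map ν C))   ≡⟨ sym (lc-zipWith-⊞ d C _) ⟩
      lc d (zipWith _⊞_ C (map (_· (a ∷ c)) (map ν C))) ≡⟨ cong (lc d) (sym (rows C)) ⟩
      lc d (map row C)                             ≡⟨ lc-heads-zero d (rows-head C) ⟩
      0# ∷ lc d (map tail (map row C))             ∎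

  eliminate : ∀ {k r} (C : Vec (V (suc k)) (suc r)) → Any (λ v → head v ≢ 0#) C → Elimination C
  eliminate ((a ∷ c) ∷ C) (here a≢0) = eliminate-by-first a c C a≢0
  eliminate (_ ∷ []) (there ())
  eliminate ((a ∷ c) ∷ C@(_ ∷ _)) (there pivot) with a ≟F 0#
  ... | no a≢0   = eliminate-by-first a c C a≢0
  ... | yes refl = record
    { reduced = c ∷ reduced
    ; lift = λ { (d₀ ∷ d) → d₀ ∷ lift d }
    ; lift-spec = λ { (d₀ ∷ d) → spec d₀ d }
    ; lift-nonzero = λ { (d₀ ∷ d) e → cong₂ _∷_ (cong head e) (lift-nonzero d (cong tail e)) }
    }
    where
    open Elimination (eliminate C pivot)
    spec : ∀ d₀ d → lc (d₀ ∷ lift d) ((0# ∷ c) ∷ C) ≡ 0# ∷ lc (d₀ ∷ d) (c ∷ reduced)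
    spec d₀ d rewrite lift-spec d = cong (_∷ (d₀ · c ⊞ lc d reduced)) (trans (+-identityʳ _) (zeroʳ d₀))

  steinitz : ∀ k r (C : Vec (V k) r) → k < r → ∃ λ d → d ≢ 𝟎 × lc d C ≡ 𝟎
  steinitz zero (suc r) C _ = 1# ∷ 𝟎 , (λ e → 0≢1 (sym (cong head e))) , V0-unique (lc (1# ∷ 𝟎) C)
    where
    V0-unique : (x : V 0) → x ≡ []
    V0-unique [] = refl
  steinitz (suc k) (suc r) C (s≤s k<r) with heads-zero? C
  ... | inj₁ zeros with steinitz k (suc r) (map tail C) (ℕ.m≤n⇒m≤1+n k<r)
  ...   | d , d≢𝟎 , e = d , d≢𝟎 , trans (lc-heads-zero d zeros) (cong (0# ∷_) e)
  steinitz (suc k) (suc r) C (s≤s k<r) | inj₂ pivot =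
    let open Elimination (eliminate C pivot)
        (d , d≢𝟎 , e) = steinitz k r reduced k<r
    in lift d , (λ lift≡𝟎 → d≢𝟎 (lift-nonzero d lift≡𝟎)) , trans (lift-spec d) (cong (0# ∷_) e)

  coordinates : ∀ {n k r} (B : Vec (V n) k) (β : Vec (V n) r) → All (InSpan B) β →
                Σ (Vec (V k) r) λ C → β ≡ map (λ c → lc c B) C
  coordinates B []      []               = [] , refl
  coordinates B (b ∷ β) ((c , b≡) ∷ ps) =
    let (C , β≡) = coordinates B β ps in c ∷ C , cong₂ _∷_ b≡ β≡

  independent-in-span⇒≤ : ∀ {n k r} (B : Vec (V n) k) (β : Vec (V n) r) →
                          LinIndep F β → All (InSpan B) β → r ≤ k
  independent-in-span⇒≤ {k = k} {r} B β independent inSpan = ℕ.≮⇒≥ λ k<r →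
    let (C , β≡) = coordinates B β inSpan
        (d , d≢𝟎 , dC≡𝟎) = steinitz k r C k<r
    in d≢𝟎 (independent d (begin
         lc d β                         ≡⟨ cong (lc d) β≡ ⟩
         lc d (map (λ c → lc c B) C)    ≡⟨ lc-compose d C B ⟩
         lc (lc d C) B                  ≡⟨ cong (λ t → lc t B) dC≡𝟎 ⟩
         lc 𝟎 B                         ≡⟨ lc-𝟎 B ⟩
         𝟎                              ∎))

  x-y≡𝟎⇒x≡y : ∀ {k} (x y : V k) → x ⊞ -1# · y ≡ 𝟎 → x ≡ y
  x-y≡𝟎⇒x≡y []      []      _ = refl
  x-y≡𝟎⇒x≡y (a ∷ x) (b ∷ y) e =
    cong₂ _∷_ (x-y≡0⇒x≡y a b (cong head e)) (x-y≡𝟎⇒x≡y x y (cong tail e))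

  lc-injective : ∀ {n r} (B : Vec (V n) r) → LinIndep F B → ∀ c c′ → lc c B ≡ lc c′ B → c ≡ c′
  lc-injective B independent c c′ e = x-y≡𝟎⇒x≡y c c′ (independent (c ⊞ -1# · c′) (begin
    lc (c ⊞ -1# · c′) B         ≡⟨ lc-⊞ c (-1# · c′) B ⟩
    lc c B ⊞ lc (-1# · c′) B    ≡⟨ cong₂ _⊞_ e (lc-· -1# c′ B) ⟩
    lc c′ B ⊞ -1# · lc c′ B     ≡⟨ x-x≡𝟎 _ ⟩
    𝟎                           ∎))

  index : ∀ k → V k → Fin (q ^ k)
  index zero    []      = fzero
  index (suc k) (a ∷ c) = combine a (index k c)

  decode-index : ∀ k (c : V k) → decode F k (index k c) ≡ c
  decode-index zero    []      = refl
  decode-index (suc k) (a ∷ c) =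
    trans (cong (λ p → proj₁ p ∷ decode F k (proj₂ p)) (remQuot-combine {q} {q ^ k} a (index k c)))
          (cong (a ∷_) (decode-index k c))

  index-decode : ∀ k (i : Fin (q ^ k)) → index k (decode F k i) ≡ i
  index-decode zero    fzero = refl
  index-decode (suc k) i rewrite index-decode k (proj₂ (remQuot {q} (q ^ k) i)) =
    combine-remQuot {q} (q ^ k) i

  decode-injective : ∀ k {i j} → decode F k i ≡ decode F k j → i ≡ j
  decode-injective k {i} {j} e =
    trans (sym (index-decode k i)) (trans (cong (index k) e) (index-decode k j))

  -- Membership in a span is decidable: try all q^r coefficient vectors.
  span? : ∀ {n r} (B : Vec (V n) r) x → Dec (InSpan B x)
  span? {r = r} B x with any? (λ i → ≡-dec _≟F_ x (lc (decode F r i) B))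
  ... | yes (i , x≡) = yes (decode F r i , x≡)
  ... | no  none     = no λ (c , x≡) →
    none (index r c , subst (λ t → x ≡ lc t B) (sym (decode-index r c)) x≡)

  -- Echelon m r describes an r-dimensional subspace of F^m
  -- by recursion on the first coordinate, with e₁ = (1,0,…,0):
  --   pivot S   : the subspace contains e₁; S describes its image under
  --               dropping the first coordinate (dimension one less);
  --   graph S φ : the subspace meets F·e₁ trivially, so it is the graph of
  --               the linear form taking the i-th basis vector of S to φᵢ.
  -- Every subspace has exactly one echelon form, and the two constructors
  -- give the q-Pascal recursion of the Gaussian binomials.
  data Echelon : ℕ → ℕ → Set where
    nil   : Echelon 0 0
    pivot : ∀ {m r} → Echelon m r → Echelon (suc m) (suc r)
    graph : ∀ {m r} → Echelon m r → V r → Echelon (suc m) r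

  e₁ : ∀ {m} → V (suc m)
  e₁ = 1# ∷ 𝟎

  basis : ∀ {m r} → Echelon m r → Vec (V m) r
  basis nil         = []
  basis (pivot S)   = e₁ ∷ zipWith _∷_ 𝟎 (basis S)
  basis (graph S φ) = zipWith _∷_ φ (basis S)

  echelon-dim≤ : ∀ {m r} → Echelon m r → r ≤ m
  echelon-dim≤ nil         = z≤n
  echelon-dim≤ (pivot S)   = s≤s (echelon-dim≤ S)
  echelon-dim≤ (graph S _) = ℕ.m≤n⇒m≤1+n (echelon-dim≤ S)

  lc-pivot : ∀ {m r} (S : Echelon m r) c₀ cs → lc (c₀ ∷ cs) (basis (pivot S)) ≡ c₀ ∷ lc cs (basis S)
  lc-pivot S c₀ cs rewrite lc-∷ cs 𝟎 (basis S) | x⊙𝟎≡0 cs =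
    cong₂ _∷_ (trans (+-identityʳ _) (*-identityʳ c₀))
              (trans (cong (_⊞ lc cs (basis S)) (a·𝟎≡𝟎 c₀)) (⊞-identityˡ _))

  basis-independent : ∀ {m r} (S : Echelon m r) → LinIndep F (basis S)
  basis-independent nil         []        _ = refl
  basis-independent (pivot S)   (c₀ ∷ cs) e =
    let e′ = trans (sym (lc-pivot S c₀ cs)) e
    in cong₂ _∷_ (cong head e′) (basis-independent S cs (cong tail e′))
  basis-independent (graph S φ) c         e =
    basis-independent S c (cong tail (trans (sym (lc-∷ c φ (basis S))) e))

  span-pivot→ : ∀ {m r} (S : Echelon m r) {x} → InSpan (basis (pivot S)) x → InSpan (basis S) (tail x)
  span-pivot→ S (c₀ ∷ cs , refl) rewrite lc-pivot S c₀ cs = cs , refl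

  span-pivot← : ∀ {m r} (S : Echelon m r) {x} → InSpan (basis S) (tail x) → InSpan (basis (pivot S)) x
  span-pivot← S {a ∷ y} (cs , y≡) = a ∷ cs , trans (cong (a ∷_) y≡) (sym (lc-pivot S a cs))

  e₁∈pivot : ∀ {m r} (S : Echelon m r) → InSpan (basis (pivot S)) e₁
  e₁∈pivot S = 1# ∷ 𝟎 , sym (trans (lc-pivot S 1# 𝟎) (cong (1# ∷_) (lc-𝟎 (basis S))))

  e₁∉graph : ∀ {m r} (S : Echelon m r) φ → ¬ InSpan (basis (graph S φ)) e₁
  e₁∉graph S φ (c , e₁≡) with trans e₁≡ (lc-∷ c φ (basis S))
  ... | e₁≡′ with basis-independent S c (sym (cong tail e₁≡′))
  ... | refl = 0≢1 (sym (trans (cong head e₁≡′) (𝟎⊙x≡0 φ)))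

  -- Existence of echelon forms, by induction on the number of coordinates:
  -- find an echelon form of the tails of β and put the first coordinate back.

  tails-in-span : ∀ {k r} (β : Vec (V (suc k)) r) → All (λ b → InSpan (map tail β) (tail b)) β
  tails-in-span β = All.map⁻ (span-self (map tail β))

  restore-head : ∀ {k r} (β : Vec (V (suc k)) r) → InSpan β e₁ →
                 ∀ {x} → InSpan (map tail β) (tail x) → InSpan β x
  restore-head β e₁∈ {a ∷ _} (c , refl) =
    subst (InSpan β) x≡ (span-⊞ β (c , refl) (span-· β u e₁∈))
    where
    h u : K
    h = c ⊙ map head β
    u = a +F (-1# *F h)
    x≡ : lc c β ⊞ u · e₁ ≡ a ∷ lc c (map tail β)
    x≡ rewrite lc-heads c β =
      cong₂ _∷_ (trans (cong (h +F_) (*-identityʳ u)) (x+[y-x]≡y h a))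
                (trans (cong (lc c (map tail β) ⊞_) (a·𝟎≡𝟎 u)) (⊞-identityʳ _))

  lift-into-span : ∀ {k r j} (β : Vec (V (suc k)) r) (Bs : Vec (V k) j) →
                   All (InSpan (map tail β)) Bs → Σ (V j) λ φ → All (InSpan β) (zipWith _∷_ φ Bs)
  lift-into-span β []       []               = [] , []
  lift-into-span β (_ ∷ Bs) ((c , refl) ∷ ps) =
    let (φ , φ-in) = lift-into-span β Bs ps
    in (c ⊙ map head β) ∷ φ , (c , sym (lc-heads c β)) ∷ φ-in

  e₁∈-scaled : ∀ {m r} {β : Vec (V (suc m)) r} u → u ≢ 0# → InSpan β (u ∷ 𝟎) → InSpan β e₁
  e₁∈-scaled {β = β} u u≢0 u∈ =
    let (u⁻¹ , uu⁻¹≡1) = inverse u u≢0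
    in subst (InSpan β) (cong₂ _∷_ (trans (*-comm u⁻¹ u) uu⁻¹≡1) (a·𝟎≡𝟎 u⁻¹)) (span-· β u⁻¹ u∈)

  echelon-pivot-case : ∀ {m r r₁} (β : Vec (V (suc m)) r) → InSpan β e₁ →
                       (S₁ : Echelon m r₁) → SameSpan (basis S₁) (map tail β) →
                       SameSpan (basis (pivot S₁)) β
  echelon-pivot-case β e₁∈ S₁ (S₁⊆ , ⊆S₁) =
    All.map (λ p → restore-head β e₁∈ (span-trans (map tail β) (basis S₁) S₁⊆ (span-pivot→ S₁ p)))
            (span-self (basis (pivot S₁))) ,
    All.map (λ p → span-pivot← S₁ (span-trans (basis S₁) (map tail β) ⊆S₁ p)) (tails-in-span β)

  echelon-graph-case : ∀ {m r r₁} (β : Vec (V (suc m)) r) → ¬ InSpan β e₁ →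
                       (S₁ : Echelon m r₁) → SameSpan (basis S₁) (map tail β) →
                       Σ (V r₁) λ φ → SameSpan (basis (graph S₁ φ)) β
  echelon-graph-case {m} β e₁∉ S₁ (S₁⊆ , ⊆S₁) =
    φ , φ-in , All.map in-graph (All.zip (span-self β , tails-in-span β))
    where
    φ = proj₁ (lift-into-span β (basis S₁) S₁⊆)
    φ-in = proj₂ (lift-into-span β (basis S₁) S₁⊆)
    G = basis (graph S₁ φ)
    -- b and the graph vector with the same tail differ by a multiple of e₁,
    -- which must vanish since e₁ ∉ span β.
    in-graph : ∀ {b} → InSpan β b × InSpan (map tail β) (tail b) → InSpan G b
    in-graph {h ∷ t} (b∈ , t∈) with span-trans (basis S₁) (map tail β) ⊆S₁ t∈
    ... | e , refl with h +F (-1# *F (e ⊙ φ)) ≟F 0#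
    ... | yes diff≡0 = e , trans (cong (_∷ lc e (basis S₁)) (x-y≡0⇒x≡y h _ diff≡0))
                                 (sym (lc-∷ e φ (basis S₁)))
    ... | no  diff≢0 = ⊥-elim (e₁∉ (e₁∈-scaled _ diff≢0 (subst (InSpan β) difference
                         (span-⊞ β b∈ (span-· β -1# (span-trans β G φ-in (e , refl)))))))
      where
      difference : (h ∷ lc e (basis S₁)) ⊞ -1# · lc e G ≡ (h +F (-1# *F (e ⊙ φ))) ∷ 𝟎
      difference rewrite lc-∷ e φ (basis S₁) = cong (h +F (-1# *F (e ⊙ φ)) ∷_) (x-x≡𝟎 _)

  echelon-form : ∀ {m r} (β : Vec (V m) r) → Σ ℕ λ r′ → Σ (Echelon m r′) λ S → SameSpan (basis S) β
  echelon-form {zero}  β = 0 , nil , [] , All.universal (λ { [] → [] , refl }) β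
  echelon-form {suc m} β with echelon-form (map tail β) | span? β e₁
  ... | r₁ , S₁ , same | yes e₁∈ = suc r₁ , pivot S₁ , echelon-pivot-case β e₁∈ S₁ same
  ... | r₁ , S₁ , same | no  e₁∉ =
    let (φ , same′) = echelon-graph-case β e₁∉ S₁ same in r₁ , graph S₁ φ , same′

  echelon-form-independent : ∀ {m r} (β : Vec (V m) r) → LinIndep F β →
                             Σ (Echelon m r) λ S → SameSpan (basis S) β
  echelon-form-independent {r = r} β independent with echelon-form β
  ... | r′ , S , S⊆ , ⊆S
    with ℕ.≤-antisym (independent-in-span⇒≤ β (basis S) (basis-independent S) S⊆)
                     (independent-in-span⇒≤ (basis S) β independent ⊆S)
  ... | refl = S , S⊆ , ⊆S

  _⊆ₛ_ : ∀ {n r k} → Vec (V n) r → Vec (V n) k → Set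
  B ⊆ₛ C = ∀ {x} → InSpan B x → InSpan C x

  ⊙-extensional : ∀ {r} (φ φ′ : V r) → (∀ c → c ⊙ φ ≡ c ⊙ φ′) → φ ≡ φ′
  ⊙-extensional []      []        _    = refl
  ⊙-extensional (a ∷ φ) (b ∷ φ′) same = cong₂ _∷_ heads (⊙-extensional φ φ′ tails)
    where
    e₁⊙ : ∀ {r} a (φ : V r) → e₁ ⊙ (a ∷ φ) ≡ a
    e₁⊙ a φ = trans (cong₂ _+F_ (*-identityˡ a) (𝟎⊙x≡0 φ)) (+-identityʳ a)
    0∷c⊙ : ∀ {r} (c : V r) a φ → (0# ∷ c) ⊙ (a ∷ φ) ≡ c ⊙ φ
    0∷c⊙ c a φ = trans (cong (_+F c ⊙ φ) (zeroˡ a)) (+-identityˡ _)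
    heads : a ≡ b
    heads = trans (sym (e₁⊙ a φ)) (trans (same e₁) (e₁⊙ b φ′))
    tails : ∀ c → c ⊙ φ ≡ c ⊙ φ′
    tails c = trans (sym (0∷c⊙ c a φ)) (trans (same (0# ∷ c)) (0∷c⊙ c b φ′))

  graph-lift : ∀ {m r} (S : Echelon m r) φ c → InSpan (basis (graph S φ)) ((c ⊙ φ) ∷ lc c (basis S))
  graph-lift S φ c = c , sym (lc-∷ c φ (basis S))

  graph-project : ∀ {m r} (S : Echelon m r) φ {a y} → InSpan (basis (graph S φ)) (a ∷ y) → InSpan (basis S) y
  graph-project S φ (c , e) = c , cong tail (trans e (lc-∷ c φ (basis S)))

  echelon-unique : ∀ {m r} (S S′ : Echelon m r) → basis S ⊆ₛ basis S′ → basis S′ ⊆ₛ basis S → S ≡ S′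
  echelon-unique nil         nil          _ _ = refl
  echelon-unique (pivot S)   (pivot S′)   ⊆ ⊇ = cong pivot (echelon-unique S S′
    (λ p → span-pivot→ S′ (⊆ (span-pivot← S {0# ∷ _} p)))
    (λ p → span-pivot→ S  (⊇ (span-pivot← S′ {0# ∷ _} p))))
  echelon-unique (pivot S)   (graph S′ φ) ⊆ _ = ⊥-elim (e₁∉graph S′ φ (⊆ (e₁∈pivot S)))
  echelon-unique (graph S φ) (pivot S′)   _ ⊇ = ⊥-elim (e₁∉graph S φ (⊇ (e₁∈pivot S′)))
  echelon-unique (graph S φ) (graph S′ φ′) ⊆ ⊇
    with echelon-unique S S′ (λ { (c , refl) → graph-project S′ φ′ (⊆ (graph-lift S φ c)) })
                             (λ { (c , refl) → graph-project S φ (⊇ (graph-lift S′ φ′ c)) })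
  ... | refl = cong (graph S) (⊙-extensional φ φ′ same-values)
    where
    -- (c ⊙ φ) ∷ lc c (basis S) lies in span (graph S φ′); independence of
    -- basis S forces its coefficients to be c, hence c ⊙ φ ≡ c ⊙ φ′.
    same-values : ∀ c → c ⊙ φ ≡ c ⊙ φ′
    same-values c with ⊆ (graph-lift S φ c)
    ... | c′ , e with trans e (lc-∷ c′ φ′ (basis S))
    ... | e′ with lc-injective (basis S) (basis-independent S) c c′ (cong tail e′)
    ... | refl = cong head e′

  count-vectors : ∀ r → CountIs {V r} (λ _ → ⊤) (q ^ r)
  count-vectors r = count-image (decode F r) (decode-injective r) (λ _ _ → tt)
    (λ c _ → index r c , tt , sym (decode-index r c)) (count-Fin (q ^ r))

  pivot-injective : ∀ {m r} {S S′ : Echelon m r} → pivot S ≡ pivot S′ → S ≡ S′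
  pivot-injective refl = refl

  graph-injective : ∀ {m r} {p p′ : Echelon m r × V r} → uncurry graph p ≡ uncurry graph p′ → p ≡ p′
  graph-injective {p = _ , _} {_ , _} refl = refl

  IsPivot IsGraph : ∀ {m r} → Echelon m r → Set
  IsPivot (pivot _)   = ⊤
  IsPivot _           = ⊥
  IsGraph (graph _ _) = ⊤
  IsGraph _           = ⊥

  count-pivot-forms : ∀ {m r} {P : Echelon (suc m) (suc r) → Set} {a} →
                      CountIs (λ S → P (pivot S)) a → CountIs (λ S → IsPivot S × P S) a
  count-pivot-forms = count-image pivot pivot-injective (λ _ p → tt , p)
    λ { (pivot S) (_ , p) → S , p , refl ; (graph _ _) (() , _) }

  count-graph-forms : ∀ {m r} {P : Echelon (suc m) r → Set} {b} →
                      CountIs (λ (S , φ) → P (graph S φ)) b → CountIs (λ S → IsGraph S × P S) b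
  count-graph-forms = count-image (uncurry graph) graph-injective (λ _ p → tt , p)
    λ { (graph S φ) (_ , p) → (S , φ) , p , refl ; (pivot _) (() , _) }

  count-pivot-or-graph : ∀ {m r} {P : Echelon (suc m) (suc r) → Set} {a b} →
                         CountIs (λ S → P (pivot S)) a → CountIs (λ (S , φ) → P (graph S φ)) b →
                         CountIs P (a + b)
  count-pivot-or-graph pivots graphs =
    count-⇔ (λ { _ (inj₁ (_ , p)) → p ; _ (inj₂ (_ , p)) → p })
            (λ { (pivot _) p → inj₁ (tt , p) ; (graph _ _) p → inj₂ (tt , p) })
            (count-⊎ (count-pivot-forms pivots) (count-graph-forms graphs)
                     λ { (pivot _) _ (() , _) ; (graph _ _) (() , _) _ })

  count-graph-only : ∀ {m} {P : Echelon (suc m) 0 → Set} {b} →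
                     CountIs (λ (S , φ) → P (graph S φ)) b → CountIs P b
  count-graph-only graphs =
    count-⇔ (λ _ → proj₂) (λ { (graph _ _) p → tt , p }) (count-graph-forms graphs)

  count-echelon : ∀ m r → CountIs {Echelon m r} (λ _ → ⊤) (gauss q m r)
  count-graph-data : ∀ m r → CountIs {Echelon m r × V r} (λ _ → ⊤) (gauss q m r * q ^ r)

  count-echelon zero    zero    = count-singleton nil tt λ { nil _ → refl }
  count-echelon zero    (suc r) = count-empty λ ()
  count-echelon (suc m) zero    = count-graph-only (count-graph-data m zero)
  count-echelon (suc m) (suc r) =
    subst (CountIs _) (cong (gauss q m r +_) (ℕ.*-comm (gauss q m (suc r)) (q ^ suc r)))
          (count-pivot-or-graph (count-echelon m r) (count-graph-data m (suc r)))

  count-graph-data m r =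
    count-⇔ (λ _ _ → tt) (λ _ _ → tt , tt) (count-× (count-echelon m r) (λ _ → count-vectors r))

  encode : ∀ {m} → V (suc m) → V (q ^ m)
  encode {m} (a ∷ v) = tabulate (λ j → a +F v ⊙ decode F m j)

  encode-RM : ∀ {m} (u : V (suc m)) → RM F m (encode u)
  encode-RM (a ∷ v) = a , v , refl

  lookup-encode : ∀ {m} a (v x : V m) → lookup (encode (a ∷ v)) (index m x) ≡ a +F v ⊙ x
  lookup-encode {m} a v x =
    trans (lookup∘tabulate _ (index m x)) (cong (λ t → a +F v ⊙ t) (decode-index m x))

  zipWith-tabulate : ∀ {n} (f : K → K → K) (g h : Fin n → K) →
                     zipWith f (tabulate g) (tabulate h) ≡ tabulate (λ j → f (g j) (h j))
  zipWith-tabulate {zero}  f g h = refl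
  zipWith-tabulate {suc n} f g h = cong (_ ∷_) (zipWith-tabulate f (λ j → g (fsuc j)) (λ j → h (fsuc j)))

  tabulate-0 : ∀ {n} → tabulate {n = n} (λ _ → 0#) ≡ 𝟎
  tabulate-0 {zero}  = refl
  tabulate-0 {suc n} = cong (0# ∷_) tabulate-0

  encode-⊞ : ∀ {m} (u u′ : V (suc m)) → encode (u ⊞ u′) ≡ encode u ⊞ encode u′
  encode-⊞ {m} (a ∷ v) (b ∷ v′) =
    trans (tabulate-cong λ j → trans (cong ((a +F b) +F_) (⊙-distribʳ v v′ _)) (+-interchange a b _ _))
          (sym (zipWith-tabulate _+F_ _ _))

  encode-· : ∀ {m} c (u : V (suc m)) → encode (c · u) ≡ c · encode u
  encode-· {m} c (a ∷ v) =
    trans (tabulate-cong λ j → trans (cong ((c *F a) +F_) (⊙-·ˡ c v _)) (sym (distribˡ c a _)))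
          (tabulate-∘ (c *F_) _)

  encode-𝟎 : ∀ {m} → encode {m} 𝟎 ≡ 𝟎
  encode-𝟎 {m} = trans (tabulate-cong λ j → trans (+-identityˡ _) (𝟎⊙x≡0 (decode F m j))) tabulate-0

  encode-lc : ∀ {m r} (c : V r) (B : Vec (V (suc m)) r) → encode (lc c B) ≡ lc c (map encode B)
  encode-lc {m} []      []      = encode-𝟎 {m}
  encode-lc (a ∷ c) (b ∷ B) =
    trans (encode-⊞ (a · b) (lc c B)) (cong₂ _⊞_ (encode-· a b) (encode-lc c B))

  affine-unique : ∀ {m} a a′ (v v′ : V m) → (∀ x → a +F v ⊙ x ≡ a′ +F v′ ⊙ x) → a ≡ a′ × v ≡ v′
  affine-unique a a′ []      []        agree =
    trans (sym (+-identityʳ a)) (trans (agree []) (+-identityʳ a′)) , refl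
  affine-unique {suc m} a a′ (b ∷ v) (b′ ∷ v′) agree
    with affine-unique a a′ v v′
           (λ x → trans (sym (at-0∷ a b v x)) (trans (agree (0# ∷ x)) (at-0∷ a′ b′ v′ x)))
    where
    at-0∷ : ∀ a b (v x : V m) → a +F ((b *F 0#) +F v ⊙ x) ≡ a +F v ⊙ x
    at-0∷ a b v x = cong (a +F_) (trans (cong (_+F v ⊙ x) (zeroʳ b)) (+-identityˡ _))
  ... | refl , refl = refl , cong (_∷ v) (+-cancelˡ a b b′ (trans (sym (at-e₁ b)) (trans (agree e₁) (at-e₁ b′))))
    where
    at-e₁ : ∀ b → a +F ((b *F 1#) +F v ⊙ 𝟎) ≡ a +F b
    at-e₁ b = cong (a +F_) (trans (cong₂ _+F_ (*-identityʳ b) (x⊙𝟎≡0 v)) (+-identityʳ b))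

  encode-injective : ∀ {m} (u u′ : V (suc m)) → encode u ≡ encode u′ → u ≡ u′
  encode-injective {m} (a ∷ v) (a′ ∷ v′) e
    with affine-unique a a′ v v′ (λ x →
           trans (sym (lookup-encode a v x)) (trans (cong (λ w → lookup w (index m x)) e) (lookup-encode a′ v′ x)))
  ... | refl , refl = refl

  span-encode : ∀ {m r} (B : Vec (V (suc m)) r) {y} → InSpan B y → InSpan (map encode B) (encode y)
  span-encode B (c , refl) = c , encode-lc c B

  span-unencode : ∀ {m r} (B : Vec (V (suc m)) r) {y} → InSpan (map encode B) (encode y) → InSpan B y
  span-unencode B {y} (c , e) = c , encode-injective y (lc c B) (trans e (sym (encode-lc c B)))

  independent-encode : ∀ {m r} (B : Vec (V (suc m)) r) → LinIndep F B → LinIndep F (map encode B)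
  independent-encode {m} B independent c e =
    independent c (encode-injective (lc c B) 𝟎 (trans (encode-lc c B) (trans e (sym (encode-𝟎 {m})))))

  ⌊⌋≡true→ : ∀ {P : Set} (d : Dec P) → ⌊ d ⌋ ≡ true → P
  ⌊⌋≡true→ d e = toWitness (Equivalence.from T-≡ e)

  ⌊⌋≡true← : ∀ {P : Set} (d : Dec P) → P → ⌊ d ⌋ ≡ true
  ⌊⌋≡true← d p = trans (isYes≗does d) (dec-true d p)

  codeBasis : ∀ {m r} → Echelon (suc m) r → Vec (V (q ^ m)) r
  codeBasis S = map encode (basis S)

  subcode : ∀ {m r} → Echelon (suc m) r → WordSet F (q ^ m)
  subcode {m} S = tabulate λ i → ⌊ span? (codeBasis S) (decode F (q ^ m) i) ⌋

  subcode-member→ : ∀ {m r} (S : Echelon (suc m) r) i →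
                    lookup (subcode S) i ≡ true → InSpan (codeBasis S) (decode F (q ^ m) i)
  subcode-member→ {m} S i i∈S =
    ⌊⌋≡true→ (span? (codeBasis S) (decode F (q ^ m) i)) (trans (sym (lookup∘tabulate _ i)) i∈S)

  subcode-member← : ∀ {m r} (S : Echelon (suc m) r) i →
                    InSpan (codeBasis S) (decode F (q ^ m) i) → lookup (subcode S) i ≡ true
  subcode-member← {m} S i p =
    trans (lookup∘tabulate _ i) (⌊⌋≡true← (span? (codeBasis S) (decode F (q ^ m) i)) p)

  subcode-isSubcode : ∀ {m r} (S : Echelon (suc m) r) → IsSubcode F (RM F m) r (subcode S)
  subcode-isSubcode {m} S =
    codeBasis S , independent-encode (basis S) (basis-independent S) ,
    (λ i → mk⇔ (λ i∈ → subcode-member→ S i ([]=⇒lookup i∈))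
               (λ p → lookup⇒[]= i _ (subcode-member← S i p))) ,
    λ i i∈ → in-RM (subcode-member→ S i ([]=⇒lookup i∈))
    where
    in-RM : ∀ {x} → InSpan (codeBasis S) x → RM F m x
    in-RM (c , refl) = subst (RM F m) (encode-lc c (basis S)) (encode-RM (lc c (basis S)))

  word∈subcode : ∀ {m r} (S : Echelon (suc m) r) (y : V (suc m)) →
                 InSpan (basis S) y → lookup (subcode S) (index (q ^ m) (encode y)) ≡ true
  word∈subcode {m} S y y∈ =
    subcode-member← S _ (subst (InSpan (codeBasis S)) (sym (decode-index (q ^ m) (encode y))) (span-encode (basis S) y∈))

  word∈subcode⁻¹ : ∀ {m r} (S : Echelon (suc m) r) (y : V (suc m)) →
                   lookup (subcode S) (index (q ^ m) (encode y)) ≡ true → InSpan (basis S) y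
  word∈subcode⁻¹ {m} S y e =
    span-unencode (basis S) (subst (InSpan (codeBasis S)) (decode-index (q ^ m) (encode y)) (subcode-member→ S _ e))

  subcode-injective : ∀ {m r} {S S′ : Echelon (suc m) r} → subcode S ≡ subcode S′ → S ≡ S′
  subcode-injective {S = S} {S′} e = echelon-unique S S′ (included S S′ e) (included S′ S (sym e))
    where
    included : ∀ S S′ → subcode S ≡ subcode S′ → basis S ⊆ₛ basis S′
    included S S′ e {y} y∈ =
      word∈subcode⁻¹ S′ y (trans (cong (λ D → lookup D _) (sym e)) (word∈subcode S y y∈))

  messages : ∀ {m k} (ws : Vec (V (q ^ m)) k) → All (RM F m) ws → Σ (Vec (V (suc m)) k) λ β → ws ≡ map encode β
  messages []       []                  = [] , refl
  messages (_ ∷ ws) ((a , v , refl) ∷ ps) =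
    let (β , ws≡) = messages ws ps in (a ∷ v) ∷ β , cong (_ ∷_) ws≡

  bool-≡ : ∀ {b b′ : Bool} → (b ≡ true → b′ ≡ true) → (b′ ≡ true → b ≡ true) → b ≡ b′
  bool-≡ {false} {false} _ _ = refl
  bool-≡ {false} {true}  _ g = g refl
  bool-≡ {true}  {false} f _ = sym (f refl)
  bool-≡ {true}  {true}  _ _ = refl

  subcode-≡ : ∀ {m r k} (S : Echelon (suc m) r) (D : WordSet F (q ^ m)) (bs : Vec (V (q ^ m)) k) →
              (∀ i → (i ∈ D) ⇔ InSpan bs (decode F (q ^ m) i)) → SameSpan (codeBasis S) bs → D ≡ subcode S
  subcode-≡ S D bs member (S⊆bs , bs⊆S) =
    trans (sym (tabulate∘lookup D)) (tabulate-cong λ i →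
      trans (bool-≡ (D⊆S i) (S⊆D i)) (lookup∘tabulate _ i))
    where
    open Equivalence
    D⊆S : ∀ i → lookup D i ≡ true → lookup (subcode S) i ≡ true
    D⊆S i i∈D =
      subcode-member← S i (span-trans (codeBasis S) bs bs⊆S (to (member i) (lookup⇒[]= i D i∈D)))
    S⊆D : ∀ i → lookup (subcode S) i ≡ true → lookup D i ≡ true
    S⊆D i i∈S = []=⇒lookup (from (member i) (span-trans bs (codeBasis S) S⊆bs (subcode-member→ S i i∈S)))

  same-span-encode : ∀ {m k r} {B : Vec (V (suc m)) k} {β : Vec (V (suc m)) r} →
                     SameSpan B β → SameSpan (map encode B) (map encode β)
  same-span-encode {B = B} {β} (B⊆β , β⊆B) =
    All.map⁺ (All.map (span-encode β) B⊆β) , All.map⁺ (All.map (span-encode B) β⊆B)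

  -- Every r-dimensional subcode is subcode S for some echelon form S: its
  -- basis words are codewords, i.e. encodings of independent messages β,
  -- and we take the echelon form of β.
  subcode-complete : ∀ {m r} (D : WordSet F (q ^ m)) → IsSubcode F (RM F m) r D →
                     Σ (Echelon (suc m) r) λ S → D ≡ subcode S
  subcode-complete {m} {r} D (bs , independent , member , inRM) =
    S , subcode-≡ S D bs member (subst (SameSpan (codeBasis S)) (sym bs≡) (same-span-encode S≈β))
    where
    open Equivalence
    n = q ^ m
    codeword : ∀ {b} → InSpan bs b → RM F m b
    codeword {b} b∈ = subst (RM F m) (decode-index n b)
      (inRM (index n b) (from (member (index n b)) (subst (InSpan bs) (sym (decode-index n b)) b∈)))
    β = proj₁ (messages bs (All.map codeword (span-self bs)))
    bs≡ = proj₂ (messages bs (All.map codeword (span-self bs)))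
    β-independent : LinIndep F β
    β-independent c e = independent c (begin
      lc c bs             ≡⟨ cong (lc c) bs≡ ⟩
      lc c (map encode β) ≡⟨ sym (encode-lc c β) ⟩
      encode (lc c β)     ≡⟨ cong encode e ⟩
      encode {m} 𝟎        ≡⟨ encode-𝟎 {m} ⟩
      𝟎                   ∎)
    S = proj₁ (echelon-form-independent β β-independent)
    S≈β = proj₂ (echelon-form-independent β β-independent)

  evaluate : ∀ {m r} → Vec (V (suc m)) r → V m → V r
  evaluate B x = map (λ u → head u +F tail u ⊙ x) B

  evaluate-0∷ : ∀ {m r} (φ : V r) (B : Vec (V m) r) x₁ x →
                evaluate (zipWith _∷_ φ (zipWith _∷_ 𝟎 B)) (x₁ ∷ x) ≡ evaluate (zipWith _∷_ φ B) x
  evaluate-0∷ []      []      x₁ x = refl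
  evaluate-0∷ (a ∷ φ) (b ∷ B) x₁ x =
    cong₂ _∷_ (cong (a +F_) (trans (cong (_+F b ⊙ x) (zeroˡ x₁)) (+-identityˡ _))) (evaluate-0∷ φ B x₁ x)

  evaluate-ψ∷ : ∀ {m r} (φ ψ : V r) (B : Vec (V m) r) x₁ x →
                evaluate (zipWith _∷_ φ (zipWith _∷_ ψ B)) (x₁ ∷ x)
                ≡ evaluate (zipWith _∷_ (φ ⊞ x₁ · ψ) B) x
  evaluate-ψ∷ []      []      []      x₁ x = refl
  evaluate-ψ∷ (a ∷ φ) (p ∷ ψ) (b ∷ B) x₁ x =
    cong₂ _∷_ (trans (sym (+-assoc a _ _)) (cong (λ t → (a +F t) +F b ⊙ x) (*-comm p x₁)))
              (evaluate-ψ∷ φ ψ B x₁ x)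

  zeros-count : ∀ {m r} (S : Echelon m r) (φ : V r) →
                CountIs {V m} (λ x → evaluate (basis (graph S φ)) x ≡ 𝟎) (q ^ (m ∸ r))
  zeros-count nil         []        = count-⇔ (λ { [] _ → refl }) (λ _ _ → tt) (count-vectors 0)
  zeros-count (pivot S₀)  (φ₀ ∷ φ)  =
    count-image (-1# *F φ₀ ∷_) (cong tail) zero→ zero← (zeros-count S₀ φ)
    where
    -- the first message is x ↦ φ₀ + x₁, the others do not involve x₁
    first : ∀ {m} x₁ (x : V m) → φ₀ +F ((1# *F x₁) +F 𝟎 ⊙ x) ≡ φ₀ +F x₁
    first x₁ x = cong (φ₀ +F_) (trans (cong₂ _+F_ (*-identityˡ x₁) (𝟎⊙x≡0 x)) (+-identityʳ x₁))
    zero→ : ∀ x → evaluate (basis (graph S₀ φ)) x ≡ 𝟎 →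
            evaluate (basis (graph (pivot S₀) (φ₀ ∷ φ))) (-1# *F φ₀ ∷ x) ≡ 𝟎
    zero→ x x-zero =
      cong₂ _∷_ (trans (first _ x) (x-x≡0 φ₀)) (trans (evaluate-0∷ φ (basis S₀) _ x) x-zero)
    zero← : ∀ y → evaluate (basis (graph (pivot S₀) (φ₀ ∷ φ))) y ≡ 𝟎 →
            ∃ λ x → evaluate (basis (graph S₀ φ)) x ≡ 𝟎 × y ≡ -1# *F φ₀ ∷ x
    zero← (x₁ ∷ x) y-zero =
      x , trans (sym (evaluate-0∷ φ (basis S₀) x₁ x)) (cong tail y-zero) ,
      cong (_∷ x) (x+y≡0⇒y≡-x φ₀ x₁ (trans (sym (first x₁ x)) (cong head y-zero)))
  -- for a graph form x₁ is free, and the remaining coordinates are the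
  -- zeros of S₂ with the constants shifted to φ + x₁ ψ
  zeros-count {suc m} {r} (graph S₂ ψ) φ =
    subst (CountIs _) (cong (q ^_) (sym (ℕ.+-∸-assoc 1 (echelon-dim≤ S₂))))
      (count-image (uncurry _∷_) ∷-injective
        (λ (x₁ , x) (_ , x-zero) → trans (evaluate-ψ∷ φ ψ (basis S₂) x₁ x) x-zero)
        (λ { (x₁ ∷ x) y-zero →
               (x₁ , x) , (tt , trans (sym (evaluate-ψ∷ φ ψ (basis S₂) x₁ x)) y-zero) , refl })
        (count-× (count-Fin q) (λ x₁ → zeros-count S₂ (φ ⊞ x₁ · ψ))))
    where
    ∷-injective : ∀ {p p′ : K × V m} → uncurry _∷_ p ≡ uncurry _∷_ p′ → p ≡ p′
    ∷-injective {_ , _} {_ , _} refl = refl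

  -- Coordinate j is outside the support exactly
  -- when the column of codeBasis S at j vanishes, i.e. when the point
  -- x = decode m j is a common zero of the basis messages.

  column : ∀ {N r} → Vec (V N) r → Fin N → V r
  column B j = map (λ b → lookup b j) B

  lookup-lc : ∀ {N r} (c : V r) (B : Vec (V N) r) j → lookup (lc c B) j ≡ c ⊙ column B j
  lookup-lc []      []      j = lookup-replicate j 0#
  lookup-lc (a ∷ c) (b ∷ B) j = trans (lookup-zipWith _+F_ j (a · b) (lc c B))
    (cong₂ _+F_ (lookup-map j (a *F_) b) (lookup-lc c B j))

  column-encode : ∀ {m r} (B : Vec (V (suc m)) r) x → column (map encode B) (index m x) ≡ evaluate B x
  column-encode []             x = refl
  column-encode ((a ∷ v) ∷ B) x = cong₂ _∷_ (lookup-encode a v x) (column-encode B x)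

  anyB≡false→ : ∀ M (f : Fin M → Bool) → anyB F M f ≡ false → ∀ i → f i ≡ false
  anyB≡false→ (suc M) f none i with f fzero in f₀
  anyB≡false→ (suc M) f none fzero    | false = f₀
  anyB≡false→ (suc M) f none (fsuc i) | false = anyB≡false→ M (λ i → f (fsuc i)) none i

  anyB≡false← : ∀ M (f : Fin M → Bool) → (∀ i → f i ≡ false) → anyB F M f ≡ false
  anyB≡false← zero    f none = refl
  anyB≡false← (suc M) f none rewrite none fzero = anyB≡false← M (λ i → f (fsuc i)) (λ i → none (fsuc i))

  supportBit : ∀ {m r} → Echelon (suc m) r → Fin (q ^ m) → Bool
  supportBit {m} S j = anyB F (q ^ (q ^ m)) λ i →
    lookup (subcode S) i ∧ not ⌊ lookup (decode F (q ^ m) i) j ≟F 0# ⌋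

  outside-support→ : ∀ {m r} (S : Echelon (suc m) r) j → supportBit S j ≡ false → column (codeBasis S) j ≡ 𝟎
  outside-support→ {m} S j outside = ⊙-extensional _ _ λ c →
    trans (sym (lookup-lc c (codeBasis S) j)) (trans (vanishes c) (sym (x⊙𝟎≡0 c)))
    where
    N = q ^ m
    vanishes : ∀ c → lookup (lc c (codeBasis S)) j ≡ 0#
    vanishes c = trans (cong (λ t → lookup t j) (sym (decode-index N w)))
                       (⌊⌋≡true→ (lookup (decode F N i) j ≟F 0#) (not-injective bit))
      where
      w = lc c (codeBasis S)
      i = index N w
      in-subcode : lookup (subcode S) i ≡ true
      in-subcode = subcode-member← S i (subst (InSpan (codeBasis S)) (sym (decode-index N w)) (c , refl))
      bit : not ⌊ lookup (decode F N i) j ≟F 0# ⌋ ≡ false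
      bit = subst (λ b → (b ∧ not ⌊ lookup (decode F N i) j ≟F 0# ⌋) ≡ false) in-subcode
                  (anyB≡false→ (q ^ N) _ outside i)

  outside-support← : ∀ {m r} (S : Echelon (suc m) r) j → column (codeBasis S) j ≡ 𝟎 → supportBit S j ≡ false
  outside-support← {m} S j column≡𝟎 = anyB≡false← (q ^ N) _ entry
    where
    N = q ^ m
    entry : ∀ i → (lookup (subcode S) i ∧ not ⌊ lookup (decode F N i) j ≟F 0# ⌋) ≡ false
    entry i with lookup (subcode S) i in i∈S
    ... | false = refl
    ... | true  =
      let (c , word≡) = subcode-member→ S i i∈S
      in cong not (⌊⌋≡true← (lookup (decode F N i) j ≟F 0#) (begin
           lookup (decode F N i) j          ≡⟨ cong (λ t → lookup t j) word≡ ⟩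
           lookup (lc c (codeBasis S)) j    ≡⟨ lookup-lc c (codeBasis S) j ⟩
           c ⊙ column (codeBasis S) j       ≡⟨ cong (c ⊙_) column≡𝟎 ⟩
           c ⊙ 𝟎                            ≡⟨ x⊙𝟎≡0 c ⟩
           0#                               ∎))

  -- Weight of the subcode described by an echelon form: a pivot form
  -- contains the all-one word; for a graph form the complement of the
  -- support is the zero set counted above.
  weight : ∀ {m r} → Echelon (suc m) r → ℕ
  weight {m}     (pivot _)   = q ^ m
  weight {m} {r} (graph _ _) = q ^ m ∸ q ^ (m ∸ r)

  wt-subcode : ∀ {m r} (S : Echelon (suc m) r) → wt F {q ^ m} (subcode S) ≡ weight S
  wt-subcode {m} (pivot S) =
    ∣tabulate∣≡ (q ^ m) (supportBit (pivot S)) 0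
      (count-empty λ j outside → column-nonzero j (outside-support→ (pivot S) j outside))
    where
    column-nonzero : ∀ j → column (codeBasis (pivot S)) j ≢ 𝟎
    column-nonzero j zero-column = 0≢1 (sym (begin
      1#                 ≡⟨ sym (trans (cong (1# +F_) (𝟎⊙x≡0 x)) (+-identityʳ 1#)) ⟩
      1# +F 𝟎 ⊙ x        ≡⟨ cong head (trans (sym (column-encode (basis (pivot S)) x))
                                        (trans (cong (column (codeBasis (pivot S))) (index-decode m j)) zero-column)) ⟩
      0#                 ∎))
      where
      x = decode F m j
  wt-subcode {m} {r} (graph S φ) =
    ∣tabulate∣≡ (q ^ m) (supportBit (graph S φ)) (q ^ (m ∸ r))
      (count-image (index m) index-injective zero→outside outside→zero (zeros-count S φ))
    where
    index-injective : ∀ {x y} → index m x ≡ index m y → x ≡ y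
    index-injective {x} {y} e = trans (sym (decode-index m x)) (trans (cong (decode F m) e) (decode-index m y))
    zero→outside : ∀ x → evaluate (basis (graph S φ)) x ≡ 𝟎 → supportBit (graph S φ) (index m x) ≡ false
    zero→outside x x-zero =
      outside-support← (graph S φ) (index m x) (trans (column-encode (basis (graph S φ)) x) x-zero)
    outside→zero : ∀ j → supportBit (graph S φ) j ≡ false →
                   ∃ λ x → evaluate (basis (graph S φ)) x ≡ 𝟎 × j ≡ index m x
    outside→zero j outside =
      decode F m j ,
      trans (sym (column-encode (basis (graph S φ)) _))
            (trans (cong (column _) (index-decode m j)) (outside-support→ (graph S φ) j outside)) ,
      sym (index-decode m j)

  count-by-weight : ∀ m r w → CountIs {Echelon (suc m) (suc r)} (λ S → weight S ≡ w)
    (gauss q m r * δ w (q ^ m) + (q ^ suc r * gauss q m (suc r)) * δ w (q ^ m ∸ q ^ (m ∸ suc r)))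
  count-by-weight m r w =
    subst (λ t → CountIs {Echelon (suc m) (suc r)} (λ S → weight S ≡ w)
                         (gauss q m r * δ w (q ^ m) + t * δ w (q ^ m ∸ q ^ (m ∸ suc r))))
          (ℕ.*-comm (gauss q m (suc r)) (q ^ suc r))
          (count-pivot-or-graph
            (count-weight (q ^ m) (λ S → weight (pivot S)) (λ _ → refl) (count-echelon m r) w)
            (count-weight _ (λ (S , φ) → weight (graph S φ)) (λ _ → refl) (count-graph-data m (suc r)) w))

  count-by-weight₀ : ∀ m w → CountIs {Echelon (suc m) 0} (λ S → weight S ≡ w) (δ w 0)
  count-by-weight₀ m w =
    subst (CountIs _) (ℕ.*-identityˡ (δ w 0))
      (count-graph-only (count-weight 0 (λ (S , φ) → weight (graph S φ)) (λ _ → ℕ.n∸n≡0 (q ^ m))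
                                      (count-graph-data m 0) w))

  count-by-weight-top : ∀ m w → CountIs {Echelon (suc m) (suc m)} (λ S → weight S ≡ w) (δ w (q ^ m))
  count-by-weight-top m w = subst (CountIs _) only-pivot (count-by-weight m m w)
    where
    only-pivot : gauss q m m * δ w (q ^ m) + (q ^ suc m * gauss q m (suc m)) * δ w (q ^ m ∸ q ^ (m ∸ suc m))
                 ≡ δ w (q ^ m)
    only-pivot rewrite gauss-diagonal q m | gauss-above q m (suc m) (ℕ.n<1+n m) | ℕ.*-zeroʳ (q ^ suc m) =
      trans (ℕ.+-identityʳ _) (ℕ.*-identityˡ _)

  count-subcodes : ∀ m r w {N} → CountIs {Echelon (suc m) r} (λ S → weight S ≡ w) N →
                   CountIs {WordSet F (q ^ m)} (λ D → IsSubcode F (RM F m) r D × wt F {q ^ m} D ≡ w) N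
  count-subcodes m r w =
    count-image subcode subcode-injective
      (λ S weight≡ → subcode-isSubcode S , trans (wt-subcode S) weight≡)
      (λ D (isSubcode , wt≡) →
         let (S , D≡) = subcode-complete D isSubcode
         in S , trans (sym (wt-subcode S)) (trans (cong (wt F {q ^ m}) (sym D≡)) wt≡) , D≡)

-- With m = s - 1: dimension 0, full dimension s, and 0 < r < s.  (The
-- argument needs only s ≥ 1; s ≥ 2 rules out s = 0.)
mainTheorem4 : ∀ {q : ℕ} (F : FiniteField q) (s : ℕ) → 2 ≤ s →
    HasGWE F (RM F (s ∸ 1)) 0 (λ w → δ w 0)
    × HasGWE F (RM F (s ∸ 1)) s (λ w → δ w (q ^ (s ∸ 1)))
    × (∀ r → 0 < r → r < s →
        HasGWE F (RM F (s ∸ 1)) r (λ w →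
          gauss q (s ∸ 1) (r ∸ 1) * δ w (q ^ (s ∸ 1))
          + (q ^ r * gauss q (s ∸ 1) r) * δ w (q ^ (s ∸ 1) ∸ q ^ (s ∸ 1 ∸ r))))
mainTheorem4 F zero    ()
mainTheorem4 F (suc m) _ =
  (λ w → count-subcodes m 0 w (count-by-weight₀ m w)) ,
  (λ w → count-subcodes m (suc m) w (count-by-weight-top m w)) ,
  λ { (suc r) _ _ w → count-subcodes m (suc r) w (count-by-weight m r w) }
  where open Theory F
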